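{- Let $1 \leq r \leq 6$ and $0 \leq c \leq \binom{r}{2}$ be integers. Then an $(r,c)$-graph exists if and only if $$(r,c) \notin \{(3,2), (4,5), (5,7), (5,8), (5,9), (6,11), (6,13), (6,14)\}.$$
   Context: All graphs are finite and simple. For a vertex $v$ of a graph $G$, $e(v)$ denotes the number of edges of the subgraph of $G$ induced by the open neighbourhood $N(v)$. An $(r,c)$-graph is an $r$-regular graph $G$ such that $e(v) = c$ for every vertex $v$ of $G$. -}

module Defs where

open import Data.Nat using (ℕ; suc; _<_)
open import Data.Fin using (Fin; toℕ)
open import Data.Bool using (Bool; true; false; _∧_)
open import Data.List using (List; filter; length; allFin; concatMap; map)
open import Data.Product using (Σ; _×_; _,_)
open import Relation.Binary.PropositionalEquality using (_≡_)
open import Relation.Nullary.Decidable using (⌊_⌋)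
open import Data.Bool.Properties using () renaming (_≟_ to _≟B_)
open import Data.Nat.Properties using (_<?_)

record Graph (n : ℕ) : Set where
  field
    adj   : Fin n → Fin n → Bool
    sym   : ∀ u v → adj u v ≡ adj v u
    irrefl : ∀ v → adj v v ≡ false
open Graph public

nbhd : ∀ {n} → Graph n → Fin n → List (Fin n)
nbhd G v = filter (λ u → adj G v u ≟B true) (allFin _)

degree : ∀ {n} → Graph n → Fin n → ℕ
degree G v = length (nbhd G v)

pairs : ∀ {n} → List (Fin n × Fin n)
pairs {n} = concatMap (λ u → map (λ w → (u , w)) (filter (λ w → toℕ u <? toℕ w) (allFin n))) (allFin n)

e : ∀ {n} → Graph n → Fin n → ℕ
e G v = length (filter (λ p → (adj G v (proj₁' p) ∧ adj G v (proj₂' p) ∧ adj G (proj₁' p) (proj₂' p)) ≟B true) pairs)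
  where
  proj₁' : _ → _
  proj₁' (a , _) = a
  proj₂' : _ → _
  proj₂' (_ , b) = b

IsRCGraph : ∀ {n} → ℕ → ℕ → Graph n → Set
IsRCGraph r c G = ∀ v → degree G v ≡ r × e G v ≡ c

RCGraphExists : ℕ → ℕ → Set
RCGraphExists r c = Σ ℕ λ m → Σ (Graph (suc m)) λ G → IsRCGraph r c G

data Exceptional : ℕ → ℕ → Set where
  e3-2  : Exceptional 3 2
  e4-5  : Exceptional 4 5
  e5-7  : Exceptional 5 7
  e5-8  : Exceptional 5 8
  e5-9  : Exceptional 5 9
  e6-11 : Exceptional 6 11
  e6-13 : Exceptional 6 13
  e6-14 : Exceptional 6 14

{-# OPTIONS --safe #-}
-- Let v be a vertex of an (r,c)-graph and M the graph induced on N(v): it has r vertices and c edges.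
-- For a neighbour u of v, sort the 2c ordered pairs (x, y) of adjacent vertices of N(u) by whether
-- x and y lie in N(v). Pairs inside N(v) are ordered edges of M inside N_M(u); a pair with only x in
-- N(v) is bounded by the r − deg_M(x) neighbours of x outside N(v); a pair with neither in N(v) lies
-- in N(u) ∖ N[v] (v has no neighbour outside N(v)), a set of r − 1 − deg_M(u) vertices. So 2c is at
-- most a quantity depending only on M and u, and for each exceptional (r,c) an exhaustive search
-- over all graphs M on r vertices with c edges finds a vertex u where this bound is below 2c.
-- The other pairs are realised by circulants, Cayley graphs of ℤ/3 × ℤ/b, the icosahedron, and the
-- icosahedron with a perfect matching added.

module Submission where

open import Defs hiding (sym)
open import Data.Nat using (ℕ; _≤_)
open import Data.Nat.Combinatorics using (_C_)
open import Relation.Nullary using (¬_)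
open import Function.Bundles using (_⇔_)

open import Data.Bool using (Bool; true; false; _∧_; _∨_; not; T)
open import Data.Bool.ListAction using (all; any)
open import Data.Bool.Properties using (∨-comm) renaming (_≟_ to _≟ᴮ_)
open import Data.Fin using (Fin; zero; suc; toℕ)
open import Data.Fin.Properties using (toℕ-injective; all?; any?) renaming (_≟_ to _≟ᶠ_)
open import Data.List using (List; []; _∷_; allFin; map; filter; length; lookup; tabulate; concatMap; cartesianProduct)
open import Data.List.Properties using (filter-++; length-++)
open import Data.List.Membership.Propositional using (_∈_)
open import Data.List.Membership.Propositional.Properties using (∈-filter⁻; ∈-lookup; ∈-map⁺; ∈-cartesianProduct⁺)
open import Data.List.Relation.Unary.Any using (here; there)
import Data.List.Relation.Unary.All as All
open import Data.List.Relation.Unary.All.Properties using (all⁺)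
open import Data.Nat using (zero; suc; _+_; _*_; _∸_; _<_; z≤n; s≤s; _/_; _%_; _≡ᵇ_; NonZero)
open import Data.Nat.Properties
open import Algebra.Properties.Semiring.Sum +-*-semiring
  using (sum; sum-syntax; sum-cong-≗; sum-replicate-zero; ∑-distrib-+; ∑-comm; *-distribˡ-sum; *-distribʳ-sum)
open import Data.Product using (_×_; _,_; proj₁; proj₂; ∃-syntax; uncurry)
open import Data.Unit using (⊤; tt)
open import Data.Vec using (Vec; []; _∷_)
import Data.Vec as Vec
open import Data.Vec.Properties using (lookup∘tabulate)
open import Function using (_∘_; id)
open import Function.Bundles using (mk⇔)
open import Relation.Binary.Definitions using (tri<; tri≈; tri>)
open import Relation.Binary.PropositionalEquality using (_≡_; refl; sym; trans; cong; cong₂; subst; module ≡-Reasoning)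
open import Relation.Nullary using (Dec; yes; no; does; contradiction)
open import Relation.Nullary.Decidable using (True; ⌊_⌋; toWitness; _×-dec_; _→-dec_; dec-true; dec-false; does-⇔)
open import Relation.Unary using (Pred; Decidable)

𝟙 : Bool → ℕ
𝟙 true  = 1
𝟙 false = 0

𝟙-∧ : ∀ p q → 𝟙 (p ∧ q) ≡ 𝟙 p * 𝟙 q
𝟙-∧ true  q = sym (+-identityʳ (𝟙 q))
𝟙-∧ false q = refl

does-≟-true : ∀ b → does (b ≟ᴮ true) ≡ b
does-≟-true true  = refl
does-≟-true false = refl

𝟙-split : ∀ p b → 𝟙 b ≡ 𝟙 (p ∧ b) + 𝟙 (not p ∧ b)
𝟙-split true  b = sym (+-identityʳ (𝟙 b))
𝟙-split false b = refl

𝟙-split₄ : ∀ p q b →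
  𝟙 b ≡ 𝟙 (p ∧ q ∧ b) + 𝟙 (p ∧ not q ∧ b) + 𝟙 (not p ∧ q ∧ b) + 𝟙 (not p ∧ not q ∧ b)
𝟙-split₄ true  true  true  = refl
𝟙-split₄ true  true  false = refl
𝟙-split₄ true  false true  = refl
𝟙-split₄ true  false false = refl
𝟙-split₄ false true  true  = refl
𝟙-split₄ false true  false = refl
𝟙-split₄ false false true  = refl
𝟙-split₄ false false false = refl

𝟙-∧-≤-*₁ : ∀ p q r s t → 𝟙 (p ∧ q ∧ r ∧ s ∧ t) ≤ 𝟙 (p ∧ r) * 𝟙 (q ∧ t)
𝟙-∧-≤-*₁ false _     _     _     _     = z≤n
𝟙-∧-≤-*₁ true  false _     _     _     = z≤n
𝟙-∧-≤-*₁ true  true  false _     _     = z≤n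
𝟙-∧-≤-*₁ true  true  true  false _     = z≤n
𝟙-∧-≤-*₁ true  true  true  true  false = z≤n
𝟙-∧-≤-*₁ true  true  true  true  true  = ≤-refl

𝟙-∧-≤-*₂ : ∀ p q r s t → 𝟙 (p ∧ q ∧ r ∧ s ∧ t) ≤ 𝟙 (q ∧ s) * 𝟙 (p ∧ t)
𝟙-∧-≤-*₂ false _     _     _     _     = z≤n
𝟙-∧-≤-*₂ true  false _     _     _     = z≤n
𝟙-∧-≤-*₂ true  true  false _     _     = z≤n
𝟙-∧-≤-*₂ true  true  true  false _     = z≤n
𝟙-∧-≤-*₂ true  true  true  true  false = z≤n
𝟙-∧-≤-*₂ true  true  true  true  true  = ≤-refl

𝟙-∧-≤-*-outside : ∀ v≟x v≟y v~x v~y u~x u~y x~y → (v≟x ≡ true → x~y ≡ v~y) → (v≟y ≡ true → x~y ≡ v~x) →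
  𝟙 (not v~x ∧ not v~y ∧ u~x ∧ u~y ∧ x~y) ≤ 𝟙 (not (v≟x ∨ v~x) ∧ u~x) * 𝟙 (not (v≟y ∨ v~y) ∧ u~y)
𝟙-∧-≤-*-outside _     _     true  _     _     _     _     _ _ = z≤n
𝟙-∧-≤-*-outside _     _     false true  _     _     _     _ _ = z≤n
𝟙-∧-≤-*-outside _     _     false false false _     _     _ _ = z≤n
𝟙-∧-≤-*-outside _     _     false false true  false _     _ _ = z≤n
𝟙-∧-≤-*-outside _     _     false false true  true  false _ _ = z≤n
𝟙-∧-≤-*-outside true  _     false false true  true  true  h _ = contradiction (h refl) λ ()
𝟙-∧-≤-*-outside false true  false false true  true  true  _ h = contradiction (h refl) λ ()
𝟙-∧-≤-*-outside false false false false true  true  true  _ _ = ≤-refl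

m≡n+o⇒m∸n≡o : ∀ {m n o} → m ≡ n + o → m ∸ n ≡ o
m≡n+o⇒m∸n≡o {n = n} {o} refl = m+n∸m≡n n o

∑-mono-≤ : ∀ {n} {f g : Fin n → ℕ} → (∀ i → f i ≤ g i) → ∑[ i < n ] f i ≤ ∑[ i < n ] g i
∑-mono-≤ {zero}  f≤g = z≤n
∑-mono-≤ {suc n} f≤g = +-mono-≤ (f≤g zero) (∑-mono-≤ (f≤g ∘ suc))

∑-𝟙-≟ : ∀ {n} (v : Fin n) → ∑[ y < n ] 𝟙 (does (v ≟ᶠ y)) ≡ 1
∑-𝟙-≟ {suc n} zero    = cong suc (sum-replicate-zero n)
∑-𝟙-≟ {suc n} (suc v) = ∑-𝟙-≟ v

∑₂ : ∀ {n} → (Fin n → Fin n → ℕ) → ℕ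
∑₂ {n} f = ∑[ x < n ] ∑[ y < n ] f x y

module _ {n : ℕ} where

  ∑₂-cong : {f g : Fin n → Fin n → ℕ} → (∀ x y → f x y ≡ g x y) → ∑₂ f ≡ ∑₂ g
  ∑₂-cong f≡g = sum-cong-≗ λ x → sum-cong-≗ (f≡g x)

  ∑₂-mono-≤ : {f g : Fin n → Fin n → ℕ} → (∀ x y → f x y ≤ g x y) → ∑₂ f ≤ ∑₂ g
  ∑₂-mono-≤ f≤g = ∑-mono-≤ λ x → ∑-mono-≤ (f≤g x)

  ∑₂-distrib-+ : (f g : Fin n → Fin n → ℕ) → ∑₂ (λ x y → f x y + g x y) ≡ ∑₂ f + ∑₂ g
  ∑₂-distrib-+ f g = trans (sum-cong-≗ λ x → ∑-distrib-+ (f x) (g x)) (∑-distrib-+ (sum ∘ f) (sum ∘ g))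

  ∑₂-transpose : (f : Fin n → Fin n → ℕ) → ∑₂ f ≡ ∑₂ (λ x y → f y x)
  ∑₂-transpose = ∑-comm

  ∑₂-*ˡ : (f : Fin n → ℕ) (g : Fin n → Fin n → ℕ) →
          ∑₂ (λ x y → f x * g x y) ≡ ∑[ x < n ] (f x * ∑[ y < n ] g x y)
  ∑₂-*ˡ f g = sum-cong-≗ λ x → sym (*-distribˡ-sum (f x) (g x))

  ∑₂-product : (f : Fin n → ℕ) → ∑₂ (λ x y → f x * f y) ≡ ∑[ x < n ] f x * ∑[ x < n ] f x
  ∑₂-product f = trans (∑₂-*ˡ f (λ _ → f)) (sym (*-distribʳ-sum (sum f) f))

module _ {a p} {A : Set a} {P : Pred A p} (P? : Decidable P) where

  length-filter≡∑ : (xs : List A) → length (filter P? xs) ≡ ∑[ j < length xs ] 𝟙 (does (P? (lookup xs j)))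
  length-filter≡∑ []       = refl
  length-filter≡∑ (x ∷ xs) with does (P? x)
  ... | true  = cong suc (length-filter≡∑ xs)
  ... | false = length-filter≡∑ xs

  length-filter-tabulate : ∀ {n} (g : Fin n → A) → length (filter P? (tabulate g)) ≡ ∑[ i < n ] 𝟙 (does (P? (g i)))
  length-filter-tabulate {zero}  g = refl
  length-filter-tabulate {suc n} g with does (P? (g zero))
  ... | true  = cong suc (length-filter-tabulate (g ∘ suc))
  ... | false = length-filter-tabulate (g ∘ suc)

  ∑-filter-tabulate : ∀ {n} (g : Fin n → A) (f : A → ℕ) →
    ∑[ i < n ] (𝟙 (does (P? (g i))) * f (g i)) ≡
    ∑[ j < length (filter P? (tabulate g)) ] f (lookup (filter P? (tabulate g)) j)
  ∑-filter-tabulate {zero}  g f = refl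
  ∑-filter-tabulate {suc n} g f with does (P? (g zero))
  ... | true  = cong₂ _+_ (+-identityʳ (f (g zero))) (∑-filter-tabulate (g ∘ suc) f)
  ... | false = ∑-filter-tabulate (g ∘ suc) f

  length-filter-map : ∀ {b} {B : Set b} (g : B → A) (xs : List B) →
                      length (filter P? (map g xs)) ≡ length (filter (P? ∘ g) xs)
  length-filter-map g []       = refl
  length-filter-map g (x ∷ xs) with does (P? (g x))
  ... | true  = cong suc (length-filter-map g xs)
  ... | false = length-filter-map g xs

  length-filter-concatMap : ∀ {b} {B : Set b} {n} (h : B → List A) (g : Fin n → B) →
    length (filter P? (concatMap h (tabulate g))) ≡ ∑[ i < n ] length (filter P? (h (g i)))
  length-filter-concatMap {n = zero}  h g = refl
  length-filter-concatMap {n = suc n} h g =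
    trans (cong length (filter-++ P? (h (g zero)) _))
          (trans (length-++ (filter P? (h (g zero))))
                 (cong (length (filter P? (h (g zero))) +_) (length-filter-concatMap h (g ∘ suc))))

module _ {n : ℕ} where

  𝟙< : Fin n → Fin n → ℕ
  𝟙< x y = 𝟙 (does (toℕ x <? toℕ y))

  ∑₂-upper-doubled : (q : Fin n → Fin n → ℕ) → (∀ x y → q x y ≡ q y x) → (∀ x → q x x ≡ 0) →
    ∑₂ (λ x y → 𝟙< x y * q x y) + ∑₂ (λ x y → 𝟙< x y * q x y) ≡ ∑₂ q
  ∑₂-upper-doubled q q-sym q-diag = begin
      U + U                                              ≡⟨ cong (U +_) (∑₂-transpose (λ x y → 𝟙< x y * q x y)) ⟩
      U + ∑₂ (λ x y → 𝟙< y x * q y x)                    ≡⟨ cong (U +_) (∑₂-cong λ x y → cong (𝟙< y x *_) (q-sym y x)) ⟩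
      U + ∑₂ (λ x y → 𝟙< y x * q x y)                    ≡⟨ ∑₂-distrib-+ (λ x y → 𝟙< x y * q x y) (λ x y → 𝟙< y x * q x y) ⟨
      ∑₂ (λ x y → 𝟙< x y * q x y + 𝟙< y x * q x y)       ≡⟨ ∑₂-cong by-order ⟩
      ∑₂ q                                               ∎
    where
    open ≡-Reasoning
    U : ℕ
    U = ∑₂ (λ x y → 𝟙< x y * q x y)
    by-order : ∀ x y → 𝟙< x y * q x y + 𝟙< y x * q x y ≡ q x y
    by-order x y with <-cmp (toℕ x) (toℕ y)
    ... | tri< x<y _ y≮x rewrite dec-true (toℕ x <? toℕ y) x<y | dec-false (toℕ y <? toℕ x) y≮x =
      trans (+-identityʳ _) (+-identityʳ _)
    ... | tri> x≮y _ y<x rewrite dec-false (toℕ x <? toℕ y) x≮y | dec-true (toℕ y <? toℕ x) y<x =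
      +-identityʳ _
    ... | tri≈ _ x≡y _ rewrite toℕ-injective x≡y | q-diag y = cong₂ _+_ (*-zeroʳ (𝟙< y y)) (*-zeroʳ (𝟙< y y))

-- Neighbourhood graphs and the local bound

module _ {n : ℕ} (R : Fin n → Fin n → Bool) where

  degreeᴿ : Fin n → ℕ
  degreeᴿ x = ∑[ y < n ] 𝟙 (R x y)

  edges₂ : ℕ
  edges₂ = ∑₂ λ x y → 𝟙 (R x y)

  nbhdEdges₂ : Fin n → ℕ
  nbhdEdges₂ x = ∑₂ λ y z → 𝟙 (R x y ∧ R x z ∧ R y z)

-- If M is the graph induced on N(v) in an r-regular graph, then 2 e(u) ≤ localBound r M i for the
-- i-th neighbour u of v.
localBound : (r : ℕ) → (Fin r → Fin r → Bool) → Fin r → ℕ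
localBound r M i = nbhdEdges₂ M i + K + K + k * k
  where
  K k : ℕ
  K = ∑[ j < r ] (𝟙 (M i j) * (r ∸ degreeᴿ M j))
  k = r ∸ suc (degreeᴿ M i)

module _ {n : ℕ} (G : Graph n) where

  private
    infix 7 _~_
    _~_ : Fin n → Fin n → Bool
    x ~ y = adj G x y

  degree≡∑ : ∀ x → degree G x ≡ ∑[ y < n ] 𝟙 (x ~ y)
  degree≡∑ x = trans (length-filter-tabulate (λ y → x ~ y ≟ᴮ true) id) (sum-cong-≗ λ y → cong 𝟙 (does-≟-true (x ~ y)))

  e≡∑ : ∀ v → e G v ≡ ∑₂ (λ x y → 𝟙< x y * 𝟙 (v ~ x ∧ v ~ y ∧ x ~ y))
  e≡∑ v = trans (length-filter-concatMap Q? later id) (sum-cong-≗ row)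
    where
    Q? : Decidable λ (p : Fin n × Fin n) → (v ~ proj₁ p ∧ v ~ proj₂ p ∧ proj₁ p ~ proj₂ p) ≡ true
    Q? (x , y) = (v ~ x ∧ v ~ y ∧ x ~ y) ≟ᴮ true
    lt? : ∀ x → Decidable λ y → toℕ x < toℕ y
    lt? x y = toℕ x <? toℕ y
    later : Fin n → List (Fin n × Fin n)
    later x = map (x ,_) (filter (lt? x) (tabulate id))
    row : ∀ x → length (filter Q? (later x)) ≡ ∑[ y < n ] (𝟙< x y * 𝟙 (v ~ x ∧ v ~ y ∧ x ~ y))
    row x = begin
      length (filter Q? (later x))                                    ≡⟨ length-filter-map Q? (x ,_) ys ⟩
      length (filter (Q? ∘ (x ,_)) ys)                                 ≡⟨ length-filter≡∑ (Q? ∘ (x ,_)) ys ⟩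
      ∑[ j < length ys ] 𝟙 (does (Q? (x , lookup ys j)))              ≡⟨ ∑-filter-tabulate (lt? x) id (λ y → 𝟙 (does (Q? (x , y)))) ⟨
      ∑[ y < n ] (𝟙< x y * 𝟙 (does (Q? (x , y))))                     ≡⟨ sum-cong-≗ (λ y → cong (λ b → 𝟙< x y * 𝟙 b) (does-≟-true _)) ⟩
      ∑[ y < n ] (𝟙< x y * 𝟙 (v ~ x ∧ v ~ y ∧ x ~ y))                 ∎
      where
      open ≡-Reasoning
      ys : List (Fin n)
      ys = filter (lt? x) (tabulate id)

  e-doubled : ∀ v → e G v + e G v ≡ nbhdEdges₂ (adj G) v
  e-doubled v = trans (cong₂ _+_ (e≡∑ v) (e≡∑ v)) (∑₂-upper-doubled q q-sym q-diag)
    where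
    q : Fin n → Fin n → ℕ
    q x y = 𝟙 (v ~ x ∧ v ~ y ∧ x ~ y)
    q-sym : ∀ x y → q x y ≡ q y x
    q-sym x y rewrite Graph.sym G x y with v ~ x | v ~ y
    ... | true  | true  = refl
    ... | true  | false = refl
    ... | false | true  = refl
    ... | false | false = refl
    q-diag : ∀ x → q x x ≡ 0
    q-diag x rewrite irrefl G x with v ~ x
    ... | true  = refl
    ... | false = refl

  module Neighbourhood (v : Fin n) where

    σ : Fin (degree G v) → Fin n
    σ = lookup (nbhd G v)

    v~σ : ∀ i → v ~ σ i ≡ true
    v~σ i = proj₂ (∈-filter⁻ (λ u → v ~ u ≟ᴮ true) {xs = allFin n} (∈-lookup i))

    ∑-restrict : (f : Fin n → ℕ) → ∑[ x < n ] (𝟙 (v ~ x) * f x) ≡ ∑[ i < degree G v ] f (σ i)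
    ∑-restrict f = trans (sum-cong-≗ λ x → cong (λ b → 𝟙 b * f x) (sym (does-≟-true (v ~ x))))
                         (∑-filter-tabulate (λ u → v ~ u ≟ᴮ true) id f)

    ∑-restrict-∧ : (h : Fin n → Bool) → ∑[ y < n ] 𝟙 (v ~ y ∧ h y) ≡ ∑[ j < degree G v ] 𝟙 (h (σ j))
    ∑-restrict-∧ h = trans (sum-cong-≗ λ y → 𝟙-∧ (v ~ y) (h y)) (∑-restrict (𝟙 ∘ h))

    ∑₂-restrict : (R : Fin n → Fin n → Bool) →
      ∑₂ (λ x y → 𝟙 (v ~ x ∧ v ~ y ∧ R x y)) ≡ ∑₂ (λ i j → 𝟙 (R (σ i) (σ j)))
    ∑₂-restrict R = begin
      ∑₂ (λ x y → 𝟙 (v ~ x ∧ v ~ y ∧ R x y))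
        ≡⟨ ∑₂-cong (λ x y → 𝟙-∧ (v ~ x) (v ~ y ∧ R x y)) ⟩
      ∑₂ (λ x y → 𝟙 (v ~ x) * 𝟙 (v ~ y ∧ R x y))
        ≡⟨ ∑₂-*ˡ (𝟙 ∘ (v ~_)) (λ x y → 𝟙 (v ~ y ∧ R x y)) ⟩
      ∑[ x < n ] (𝟙 (v ~ x) * ∑[ y < n ] 𝟙 (v ~ y ∧ R x y))
        ≡⟨ sum-cong-≗ (λ x → cong (𝟙 (v ~ x) *_) (∑-restrict-∧ (R x))) ⟩
      ∑[ x < n ] (𝟙 (v ~ x) * ∑[ j < degree G v ] 𝟙 (R x (σ j)))
        ≡⟨ ∑-restrict (λ x → ∑[ j < degree G v ] 𝟙 (R x (σ j))) ⟩
      ∑₂ (λ i j → 𝟙 (R (σ i) (σ j)))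
        ∎
      where open ≡-Reasoning

    outside : Fin n → Bool
    outside y = not (does (v ≟ᶠ y) ∨ v ~ y)

    commonDegree farDegree outsideDegree farDegreeSum : Fin n → ℕ
    commonDegree  x = ∑[ y < n ] 𝟙 (v ~ y ∧ x ~ y)
    farDegree     x = ∑[ y < n ] 𝟙 (not (v ~ y) ∧ x ~ y)
    outsideDegree x = ∑[ y < n ] 𝟙 (outside y ∧ x ~ y)
    farDegreeSum  u = ∑[ x < n ] (𝟙 (v ~ x ∧ u ~ x) * farDegree x)

    degree-split : ∀ x → degree G x ≡ commonDegree x + farDegree x
    degree-split x = trans (degree≡∑ x) (trans (sum-cong-≗ λ y → 𝟙-split (v ~ y) (x ~ y))
                                                 (∑-distrib-+ (λ y → 𝟙 (v ~ y ∧ x ~ y)) (λ y → 𝟙 (not (v ~ y) ∧ x ~ y))))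

    farDegree-neighbour : ∀ {u} → v ~ u ≡ true → farDegree u ≡ suc (outsideDegree u)
    farDegree-neighbour {u} v~u =
      trans (sum-cong-≗ split)
            (trans (∑-distrib-+ (λ y → 𝟙 (does (v ≟ᶠ y))) (λ y → 𝟙 (outside y ∧ u ~ y)))
                   (cong (_+ outsideDegree u) (∑-𝟙-≟ v)))
      where
      split : ∀ y → 𝟙 (not (v ~ y) ∧ u ~ y) ≡ 𝟙 (does (v ≟ᶠ y)) + 𝟙 (outside y ∧ u ~ y)
      split y with v ≟ᶠ y
      ... | yes refl = cong 𝟙 (trans (cong (λ b → not b ∧ u ~ v) (irrefl G v)) (trans (Graph.sym G u v) v~u))
      ... | no  _    = refl

    far-far-≤ : ∀ u x y → 𝟙 (not (v ~ x) ∧ not (v ~ y) ∧ u ~ x ∧ u ~ y ∧ x ~ y) ≤ 𝟙 (outside x ∧ u ~ x) * 𝟙 (outside y ∧ u ~ y)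
    far-far-≤ u x y with v ≟ᶠ x | v ≟ᶠ y
    ... | yes refl | yes refl = 𝟙-∧-≤-*-outside true  true  (v ~ v) (v ~ v) (u ~ v) (u ~ v) (v ~ v) (λ _ → refl) (λ _ → refl)
    ... | yes refl | no  _    = 𝟙-∧-≤-*-outside true  false (v ~ v) (v ~ y) (u ~ v) (u ~ y) (v ~ y) (λ _ → refl) (λ ())
    ... | no  _    | yes refl = 𝟙-∧-≤-*-outside false true  (v ~ x) (v ~ v) (u ~ x) (u ~ v) (x ~ v) (λ ()) (λ _ → Graph.sym G x v)
    ... | no  _    | no  _    = 𝟙-∧-≤-*-outside false false (v ~ x) (v ~ y) (u ~ x) (u ~ y) (x ~ y) (λ ()) (λ ())

    nbhdEdges₂-≤ : ∀ u → nbhdEdges₂ (adj G) u ≤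
      ∑₂ (λ x y → 𝟙 (v ~ x ∧ v ~ y ∧ u ~ x ∧ u ~ y ∧ x ~ y)) + farDegreeSum u + farDegreeSum u + outsideDegree u * outsideDegree u
    nbhdEdges₂-≤ u = begin
      ∑₂ (λ x y → 𝟙 (u ~ x ∧ u ~ y ∧ x ~ y))
        ≡⟨ ∑₂-cong (λ x y → 𝟙-split₄ (v ~ x) (v ~ y) (u ~ x ∧ u ~ y ∧ x ~ y)) ⟩
      ∑₂ (λ x y → NN x y + NF x y + FN x y + FF x y)
        ≡⟨ trans (∑₂-distrib-+ (λ x y → NN x y + NF x y + FN x y) FF)
                 (cong (_+ ∑₂ FF) (trans (∑₂-distrib-+ (λ x y → NN x y + NF x y) FN)
                                         (cong (_+ ∑₂ FN) (∑₂-distrib-+ NN NF)))) ⟩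
      ∑₂ NN + ∑₂ NF + ∑₂ FN + ∑₂ FF
        ≤⟨ +-mono-≤ (+-mono-≤ (+-mono-≤ ≤-refl NF≤) FN≤) FF≤ ⟩
      ∑₂ NN + farDegreeSum u + farDegreeSum u + outsideDegree u * outsideDegree u
        ∎
      where
      open ≤-Reasoning
      NN NF FN FF g : Fin n → Fin n → ℕ
      NN x y = 𝟙 (v ~ x ∧ v ~ y ∧ u ~ x ∧ u ~ y ∧ x ~ y)
      NF x y = 𝟙 (v ~ x ∧ not (v ~ y) ∧ u ~ x ∧ u ~ y ∧ x ~ y)
      FN x y = 𝟙 (not (v ~ x) ∧ v ~ y ∧ u ~ x ∧ u ~ y ∧ x ~ y)
      FF x y = 𝟙 (not (v ~ x) ∧ not (v ~ y) ∧ u ~ x ∧ u ~ y ∧ x ~ y)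
      g  x y = 𝟙 (v ~ x ∧ u ~ x) * 𝟙 (not (v ~ y) ∧ x ~ y)
      ∑₂g≡ : ∑₂ g ≡ farDegreeSum u
      ∑₂g≡ = ∑₂-*ˡ (λ x → 𝟙 (v ~ x ∧ u ~ x)) (λ x y → 𝟙 (not (v ~ y) ∧ x ~ y))
      NF≤ : ∑₂ NF ≤ farDegreeSum u
      NF≤ = ≤-trans (∑₂-mono-≤ λ x y → 𝟙-∧-≤-*₁ (v ~ x) (not (v ~ y)) (u ~ x) (u ~ y) (x ~ y)) (≤-reflexive ∑₂g≡)
      FN≤ : ∑₂ FN ≤ farDegreeSum u
      FN≤ = ≤-trans (∑₂-mono-≤ λ x y → subst (λ b → FN x y ≤ 𝟙 (v ~ y ∧ u ~ y) * 𝟙 (not (v ~ x) ∧ b)) (Graph.sym G x y)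
                                             (𝟙-∧-≤-*₂ (not (v ~ x)) (v ~ y) (u ~ x) (u ~ y) (x ~ y)))
                    (≤-reflexive (trans (sym (∑₂-transpose g)) ∑₂g≡))
      FF≤ : ∑₂ FF ≤ outsideDegree u * outsideDegree u
      FF≤ = ≤-trans (∑₂-mono-≤ (far-far-≤ u)) (≤-reflexive (∑₂-product (λ x → 𝟙 (outside x ∧ u ~ x))))

    module Induced (M : Fin (degree G v) → Fin (degree G v) → Bool) (M≗ : ∀ i j → M i j ≡ σ i ~ σ j) where

      e-centre : e G v + e G v ≡ edges₂ M
      e-centre = trans (e-doubled v) (trans (∑₂-restrict _~_) (∑₂-cong λ i j → cong 𝟙 (sym (M≗ i j))))

      commonDegree-σ : ∀ j → commonDegree (σ j) ≡ degreeᴿ M j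
      commonDegree-σ j = trans (∑-restrict-∧ (σ j ~_)) (sum-cong-≗ λ l → cong 𝟙 (sym (M≗ j l)))

      nbhdEdges₂-σ : ∀ i → nbhdEdges₂ M i ≡ ∑₂ (λ x y → 𝟙 (v ~ x ∧ v ~ y ∧ σ i ~ x ∧ σ i ~ y ∧ x ~ y))
      nbhdEdges₂-σ i = sym (trans (∑₂-restrict (λ x y → σ i ~ x ∧ σ i ~ y ∧ x ~ y))
                                  (∑₂-cong λ j l → cong 𝟙 (sym (cong₂ _∧_ (M≗ i j) (cong₂ _∧_ (M≗ i l) (M≗ j l))))))

      module _ (regular : ∀ x → degree G x ≡ degree G v) where

        farDegree-σ : ∀ j → degree G v ∸ degreeᴿ M j ≡ farDegree (σ j)
        farDegree-σ j = m≡n+o⇒m∸n≡o (begin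
          degree G v                                ≡⟨ regular (σ j) ⟨
          degree G (σ j)                            ≡⟨ degree-split (σ j) ⟩
          commonDegree (σ j) + farDegree (σ j)      ≡⟨ cong (_+ farDegree (σ j)) (commonDegree-σ j) ⟩
          degreeᴿ M j + farDegree (σ j)             ∎)
          where open ≡-Reasoning

        outsideDegree-σ : ∀ i → degree G v ∸ suc (degreeᴿ M i) ≡ outsideDegree (σ i)
        outsideDegree-σ i = m≡n+o⇒m∸n≡o (begin
          degree G v                                          ≡⟨ regular (σ i) ⟨
          degree G (σ i)                                      ≡⟨ degree-split (σ i) ⟩
          commonDegree (σ i) + farDegree (σ i)                ≡⟨ cong₂ _+_ (commonDegree-σ i) (farDegree-neighbour (v~σ i)) ⟩
          degreeᴿ M i + suc (outsideDegree (σ i))             ≡⟨ +-suc (degreeᴿ M i) (outsideDegree (σ i)) ⟩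
          suc (degreeᴿ M i) + outsideDegree (σ i)             ∎)
          where open ≡-Reasoning

        farDegreeSum-σ : ∀ i → ∑[ j < degree G v ] (𝟙 (M i j) * (degree G v ∸ degreeᴿ M j)) ≡ farDegreeSum (σ i)
        farDegreeSum-σ i = sym (begin
          ∑[ x < n ] (𝟙 (v ~ x ∧ u ~ x) * farDegree x)
            ≡⟨ sum-cong-≗ (λ x → trans (cong (_* farDegree x) (𝟙-∧ (v ~ x) (u ~ x))) (*-assoc (𝟙 (v ~ x)) _ _)) ⟩
          ∑[ x < n ] (𝟙 (v ~ x) * (𝟙 (u ~ x) * farDegree x))
            ≡⟨ ∑-restrict (λ x → 𝟙 (u ~ x) * farDegree x) ⟩
          ∑[ j < degree G v ] (𝟙 (u ~ σ j) * farDegree (σ j))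
            ≡⟨ sum-cong-≗ (λ j → cong₂ _*_ (cong 𝟙 (sym (M≗ i j))) (sym (farDegree-σ j))) ⟩
          ∑[ j < degree G v ] (𝟙 (M i j) * (degree G v ∸ degreeᴿ M j))
            ∎)
          where
          open ≡-Reasoning
          u : Fin n
          u = σ i

        e-neighbour-≤ : ∀ i → e G (σ i) + e G (σ i) ≤ localBound (degree G v) M i
        e-neighbour-≤ i = begin
          e G u + e G u
            ≡⟨ e-doubled u ⟩
          nbhdEdges₂ (adj G) u
            ≤⟨ nbhdEdges₂-≤ u ⟩
          ∑₂ (λ x y → 𝟙 (v ~ x ∧ v ~ y ∧ u ~ x ∧ u ~ y ∧ x ~ y)) + farDegreeSum u + farDegreeSum u
            + outsideDegree u * outsideDegree u
            ≡⟨ cong₂ _+_ (cong₂ _+_ (cong₂ _+_ (nbhdEdges₂-σ i) (farDegreeSum-σ i)) (farDegreeSum-σ i))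
                         (cong₂ _*_ (outsideDegree-σ i) (outsideDegree-σ i)) ⟨
          localBound (degree G v) M i
            ∎
          where
          open ≤-Reasoning
          u : Fin n
          u = σ i

-- Exhaustive search over graphs on r vertices

-- A code lists the strict upper triangle of an adjacency matrix, row by row.
Code : ℕ → Set
Code zero    = ⊤
Code (suc r) = Vec Bool r × Code r

adjOf : ∀ {r} → Code r → Fin r → Fin r → Bool
adjOf (row , B) zero    zero    = false
adjOf (row , B) zero    (suc j) = Vec.lookup row j
adjOf (row , B) (suc i) zero    = Vec.lookup row i
adjOf (row , B) (suc i) (suc j) = adjOf B i j

encode : ∀ {r} → (Fin r → Fin r → Bool) → Code r
encode {zero}  M = tt
encode {suc r} M = Vec.tabulate (M zero ∘ suc) , encode (λ i j → M (suc i) (suc j))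

adjOf-encode : ∀ {r} (M : Fin r → Fin r → Bool) → (∀ i j → M i j ≡ M j i) → (∀ i → M i i ≡ false) →
               ∀ i j → adjOf (encode M) i j ≡ M i j
adjOf-encode M M-sym M-irr zero    zero    = sym (M-irr zero)
adjOf-encode M M-sym M-irr zero    (suc j) = lookup∘tabulate (M zero ∘ suc) j
adjOf-encode M M-sym M-irr (suc i) zero    = trans (lookup∘tabulate (M zero ∘ suc) i) (M-sym zero (suc i))
adjOf-encode M M-sym M-irr (suc i) (suc j) =
  adjOf-encode (λ i j → M (suc i) (suc j)) (λ i j → M-sym (suc i) (suc j)) (M-irr ∘ suc) i j

allVecs : ∀ k → List (Vec Bool k)
allVecs zero    = [] ∷ []
allVecs (suc k) = map (uncurry _∷_) (cartesianProduct (true ∷ false ∷ []) (allVecs k))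

∈-allVecs : ∀ {k} (w : Vec Bool k) → w ∈ allVecs k
∈-allVecs []      = here refl
∈-allVecs (b ∷ w) = ∈-map⁺ (uncurry _∷_) (∈-cartesianProduct⁺ (∈-bools b) (∈-allVecs w))
  where
  ∈-bools : ∀ b → b ∈ true ∷ false ∷ []
  ∈-bools true  = here refl
  ∈-bools false = there (here refl)

allCodes : ∀ r → List (Code r)
allCodes zero    = tt ∷ []
allCodes (suc r) = cartesianProduct (allVecs r) (allCodes r)

∈-allCodes : ∀ {r} (B : Code r) → B ∈ allCodes r
∈-allCodes {zero}  tt        = here refl
∈-allCodes {suc r} (row , B) = ∈-cartesianProduct⁺ (∈-allVecs row) (∈-allCodes B)

LocallyRefuted : ℕ → ℕ → Set
LocallyRefuted r c = (B : Code r) → edges₂ (adjOf B) ≡ c + c → ∃[ i ] localBound r (adjOf B) i < c + c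

refutes? : ∀ {r} c (B : Code r) → Dec (edges₂ (adjOf B) ≡ c + c → ∃[ i ] localBound r (adjOf B) i < c + c)
refutes? {r} c B = edges₂ (adjOf B) ≟ c + c →-dec any? λ i → localBound r (adjOf B) i <? c + c

locallyRefuted : ∀ r c → {T (all (λ B → ⌊ refutes? c B ⌋) (allCodes r))} → LocallyRefuted r c
locallyRefuted r c {checked} B = toWitness (All.lookup (all⁺ (λ B → ⌊ refutes? c B ⌋) (allCodes r) checked) (∈-allCodes B))

exceptional-refuted : ∀ {r c} → Exceptional r c → LocallyRefuted r c
exceptional-refuted e3-2  = locallyRefuted 3 2
exceptional-refuted e4-5  = locallyRefuted 4 5
exceptional-refuted e5-7  = locallyRefuted 5 7
exceptional-refuted e5-8  = locallyRefuted 5 8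
exceptional-refuted e5-9  = locallyRefuted 5 9
exceptional-refuted e6-11 = locallyRefuted 6 11
exceptional-refuted e6-13 = locallyRefuted 6 13
exceptional-refuted e6-14 = locallyRefuted 6 14

nonexistence : ∀ {r c} → LocallyRefuted r c → ¬ RCGraphExists r c
nonexistence {c = c} refuted (_ , G , rc) = <-irrefl refl (≤-<-trans c+c≤bound bound<c+c)
  where
  open Neighbourhood G zero
  M : Fin (degree G zero) → Fin (degree G zero) → Bool
  M = adjOf (encode λ i j → adj G (σ i) (σ j))
  M≗ : ∀ i j → M i j ≡ adj G (σ i) (σ j)
  M≗ = adjOf-encode (λ i j → adj G (σ i) (σ j)) (λ i j → Graph.sym G (σ i) (σ j)) (λ i → irrefl G (σ i))
  open Induced M M≗
  regular : ∀ x → degree G x ≡ degree G zero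
  regular x = trans (proj₁ (rc x)) (sym (proj₁ (rc zero)))
  witness : ∃[ i ] localBound (degree G zero) M i < c + c
  witness = subst (λ d → LocallyRefuted d c) (sym (proj₁ (rc zero))) refuted _
                  (trans (sym e-centre) (cong₂ _+_ (proj₂ (rc zero)) (proj₂ (rc zero))))
  i : Fin (degree G zero)
  i = proj₁ witness
  bound<c+c : localBound (degree G zero) M i < c + c
  bound<c+c = proj₂ witness
  c+c≤bound : c + c ≤ localBound (degree G zero) M i
  c+c≤bound = subst (λ m → m + m ≤ localBound (degree G zero) M i) (proj₂ (rc (σ i))) (e-neighbour-≤ regular i)

-- Constructions

underlying : ∀ {n} → (Fin n → Fin n → Bool) → Graph n
underlying R = record
  { adj    = λ x y → not (does (x ≟ᶠ y)) ∧ (R x y ∨ R y x)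
  ; sym    = λ x y → cong₂ (λ b b′ → not b ∧ b′) (does-⇔ (mk⇔ sym sym) (x ≟ᶠ y) (y ≟ᶠ x)) (∨-comm (R x y) (R y x))
  ; irrefl = λ x → cong (λ b → not b ∧ (R x x ∨ R x x)) (dec-true (x ≟ᶠ x) refl)
  }

_∈ᵇ_ : ℕ × ℕ → List (ℕ × ℕ) → Bool
(p , q) ∈ᵇ S = any (λ (s , t) → (s ≡ᵇ p) ∧ (t ≡ᵇ q)) S

fromEdges : (n : ℕ) → List (ℕ × ℕ) → Graph n
fromEdges n E = underlying λ x y → (toℕ x , toℕ y) ∈ᵇ E

minusMod : (m : ℕ) .{{_ : NonZero m}} → ℕ → ℕ → ℕ
minusMod m q p = (q + m ∸ p) % m

-- Vertex x stands for (x / b , x % b) ∈ ℤ/a × ℤ/b and is adjacent to y when ±(y − x) ∈ S.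
cayley : (a b : ℕ) .{{_ : NonZero a}} .{{_ : NonZero b}} → List (ℕ × ℕ) → Graph (a * b)
cayley a b S = underlying λ x y →
  (minusMod a (toℕ y / b) (toℕ x / b) , minusMod b (toℕ y % b) (toℕ x % b)) ∈ᵇ S

circulant : (n : ℕ) .{{_ : NonZero n}} → List ℕ → Graph (1 * n)
circulant n S = cayley 1 n (map (0 ,_) S)

isRCGraph? : ∀ {n} r c (G : Graph n) → Dec (IsRCGraph r c G)
isRCGraph? r c G = all? λ v → degree G v ≟ r ×-dec e G v ≟ c

realised : ∀ {r c n} (G : Graph (suc n)) → {True (isRCGraph? r c G)} → RCGraphExists r c
realised G {rc} = _ , G , toWitness rc

icosahedron : Graph 12
icosahedron = fromEdges 12
  ( (0 , 1) ∷ (0 , 2) ∷ (0 , 3) ∷ (0 , 4) ∷ (0 , 6) ∷ (1 , 2) ∷ (1 , 6) ∷ (1 , 8) ∷ (1 , 9) ∷ (2 , 3)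
  ∷ (2 , 9) ∷ (2 , 10) ∷ (3 , 4) ∷ (3 , 5) ∷ (3 , 10) ∷ (4 , 5) ∷ (4 , 6) ∷ (4 , 7) ∷ (5 , 7) ∷ (5 , 10)
  ∷ (5 , 11) ∷ (6 , 7) ∷ (6 , 8) ∷ (7 , 8) ∷ (7 , 11) ∷ (8 , 9) ∷ (8 , 11) ∷ (9 , 10) ∷ (9 , 11) ∷ (10 , 11) ∷ [])

-- The icosahedron plus a perfect matching of vertices at distance two.
icosahedron⁺ : Graph 12
icosahedron⁺ = underlying λ x y → adj icosahedron x y ∨ (toℕ x , toℕ y) ∈ᵇ matching
  where
  matching : List (ℕ × ℕ)
  matching = (0 , 8) ∷ (1 , 10) ∷ (2 , 4) ∷ (3 , 11) ∷ (5 , 6) ∷ (7 , 9) ∷ []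

existence : ∀ r c → 1 ≤ r → r ≤ 6 → c ≤ r C 2 → ¬ Exceptional r c → RCGraphExists r c
existence 1  0 _ _ _ _ = realised (circulant 2 (1 ∷ []))
existence 2  0 _ _ _ _ = realised (circulant 4 (1 ∷ []))
existence 2  1 _ _ _ _ = realised (circulant 3 (1 ∷ []))
existence 3  0 _ _ _ _ = realised (circulant 6 (1 ∷ 3 ∷ []))
existence 3  1 _ _ _ _ = realised (circulant 6 (2 ∷ 3 ∷ []))
existence 3  3 _ _ _ _ = realised (circulant 4 (1 ∷ 2 ∷ []))
existence 4  0 _ _ _ _ = realised (circulant 8 (1 ∷ 3 ∷ []))
existence 4  1 _ _ _ _ = realised (circulant 9 (1 ∷ 3 ∷ []))
existence 4  2 _ _ _ _ = realised (cayley 3 3 ((0 , 1) ∷ (1 , 0) ∷ []))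
existence 4  3 _ _ _ _ = realised (circulant 7 (1 ∷ 2 ∷ []))
existence 4  4 _ _ _ _ = realised (circulant 6 (1 ∷ 2 ∷ []))
existence 4  6 _ _ _ _ = realised (circulant 5 (1 ∷ 2 ∷ []))
existence 5  0 _ _ _ _ = realised (circulant 10 (1 ∷ 3 ∷ 5 ∷ []))
existence 5  1 _ _ _ _ = realised (circulant 12 (1 ∷ 4 ∷ 6 ∷ []))
existence 5  2 _ _ _ _ = realised (cayley 3 6 ((0 , 2) ∷ (0 , 3) ∷ (1 , 0) ∷ []))
existence 5  3 _ _ _ _ = realised (circulant 10 (1 ∷ 2 ∷ 5 ∷ []))
existence 5  4 _ _ _ _ = realised (circulant 12 (3 ∷ 4 ∷ 6 ∷ []))
existence 5  5 _ _ _ _ = realised icosahedron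
existence 5  6 _ _ _ _ = realised (circulant 8 (1 ∷ 2 ∷ 4 ∷ []))
existence 5 10 _ _ _ _ = realised (circulant 6 (1 ∷ 2 ∷ 3 ∷ []))
existence 6  0 _ _ _ _ = realised (circulant 12 (1 ∷ 3 ∷ 5 ∷ []))
existence 6  1 _ _ _ _ = realised (circulant 15 (1 ∷ 3 ∷ 5 ∷ []))
existence 6  2 _ _ _ _ = realised (cayley 3 6 ((0 , 1) ∷ (1 , 0) ∷ (1 , 2) ∷ []))
existence 6  3 _ _ _ _ = realised (circulant 13 (1 ∷ 2 ∷ 5 ∷ []))
existence 6  4 _ _ _ _ = realised (circulant 12 (2 ∷ 3 ∷ 4 ∷ []))
existence 6  5 _ _ _ _ = realised (cayley 3 6 ((0 , 1) ∷ (0 , 2) ∷ (1 , 0) ∷ []))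
existence 6  6 _ _ _ _ = realised (circulant 11 (1 ∷ 2 ∷ 4 ∷ []))
existence 6  7 _ _ _ _ = realised (circulant 12 (1 ∷ 2 ∷ 4 ∷ []))
existence 6  8 _ _ _ _ = realised icosahedron⁺
existence 6  9 _ _ _ _ = realised (circulant 9 (1 ∷ 2 ∷ 4 ∷ []))
existence 6 10 _ _ _ _ = realised (circulant 9 (1 ∷ 2 ∷ 3 ∷ []))
existence 6 12 _ _ _ _ = realised (circulant 8 (1 ∷ 2 ∷ 3 ∷ []))
existence 6 15 _ _ _ _ = realised (circulant 7 (1 ∷ 2 ∷ 3 ∷ []))
existence 3  2 _ _ _ ¬exc = contradiction e3-2 ¬exc
existence 4  5 _ _ _ ¬exc = contradiction e4-5 ¬exc
existence 5  7 _ _ _ ¬exc = contradiction e5-7 ¬exc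
existence 5  8 _ _ _ ¬exc = contradiction e5-8 ¬exc
existence 5  9 _ _ _ ¬exc = contradiction e5-9 ¬exc
existence 6 11 _ _ _ ¬exc = contradiction e6-11 ¬exc
existence 6 13 _ _ _ ¬exc = contradiction e6-13 ¬exc
existence 6 14 _ _ _ ¬exc = contradiction e6-14 ¬exc
existence 0 _ () _ _ _
existence (suc (suc (suc (suc (suc (suc (suc _))))))) _ _ (s≤s (s≤s (s≤s (s≤s (s≤s (s≤s ())))))) _ _
existence 1 (suc _) _ _ () _
existence 2 (suc (suc _)) _ _ (s≤s ()) _
existence 3 (suc (suc (suc (suc _)))) _ _ (s≤s (s≤s (s≤s ()))) _
existence 4 (suc (suc (suc (suc (suc (suc (suc _))))))) _ _ (s≤s (s≤s (s≤s (s≤s (s≤s (s≤s ())))))) _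
existence 5 (suc (suc (suc (suc (suc (suc (suc (suc (suc (suc (suc _))))))))))) _ _
  (s≤s (s≤s (s≤s (s≤s (s≤s (s≤s (s≤s (s≤s (s≤s (s≤s ())))))))))) _
existence 6 (suc (suc (suc (suc (suc (suc (suc (suc (suc (suc (suc (suc (suc (suc (suc (suc _)))))))))))))))) _ _
  (s≤s (s≤s (s≤s (s≤s (s≤s (s≤s (s≤s (s≤s (s≤s (s≤s (s≤s (s≤s (s≤s (s≤s (s≤s ()))))))))))))))) _

mainTheorem3 : (r c : ℕ) → 1 ≤ r → r ≤ 6 → c ≤ r C 2 →
    RCGraphExists r c ⇔ (¬ Exceptional r c)
mainTheorem3 r c 1≤r r≤6 c≤ = mk⇔ (λ rcGraph exc → nonexistence (exceptional-refuted exc) rcGraph) (existence r c 1≤r r≤6 c≤)
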